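{- Let $k\ge 1$ and $b\in\mathbb{N}$ be integers, and let $\alpha:[k]^b\times[b]\to[k]\cup\{\bot\}$ be a function such that for every word $w\in[k]^b$ and every $i\in[b]$ we have $\alpha(w,i)\neq\bot$ if and only if $w_i=1$. Then there is a bijection $\phi:[k]^b\to[k]^b$ such that for every $w\in[k]^b$ and every $i\in[b]$, if $w_i=1$ then $\phi(w)_i=\alpha(w,i)$.
   Context: $[k]=\{1,\dots,k\}$ and $\mathbb{N}$ contains $0$. Elements of $[k]^b$ are words of length $b$ over the alphabet $[k]$; $w_i$ denotes the $i$-th letter of $w$. $\bot$ is a symbol not in $[k]$. (In the paper the domain is a formally distinct copy of $[k]^b$, which does not affect the statement.) -}

module Defs where

open import Data.Nat using (ℕ; suc; NonZero)
open import Data.Fin using (Fin; zero)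
open import Data.Vec using (Vec)

-- Alphabet [k] is Fin k; its letters 1,…,k are zero,…,fromℕ k-1.
-- Words of length b over [k].
Word : ℕ → ℕ → Set
Word k b = Vec (Fin k) b

letter1 : (k : ℕ) → .{{NonZero k}} → Fin k
letter1 (suc k) = zero

-- For a word x ∷ v, first permute the tail by the
-- bijection ψₓ obtained recursively for the words starting with x, giving
-- x ∷ u; then permute the first letter by the transposition of 1 and
-- c(u) = α(1 ∷ ψ₁⁻¹ u, 0). Each step is a bijection because it permutes one
-- part of the word by a permutation depending only on the other part, and
-- for x = 1 the first letter is sent to c(ψ₁ v) = α(1 ∷ v, 0), as required.
module Submission where

open import Defs
open import Data.Nat using (ℕ; NonZero; zero; suc)
open import Data.Fin using (Fin; zero; suc; _≟_)
open import Data.Fin.Permutation using (transpose; _⟨$⟩ʳ_)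
open import Data.Vec using (Vec; _∷_; lookup)
open import Data.Maybe using (Maybe; just; nothing; fromMaybe)
open import Data.Product using (Σ; _,_; proj₁; proj₂)
open import Function.Bundles using (_⤖_; _↔_; _⇔_; Bijection; Inverse; Equivalence; mk↔ₛ′)
open import Function.Construct.Composition using (_↔-∘_)
open import Function.Construct.Identity using (↔-id)
open import Function.Properties.Inverse using (↔⇒⤖)
open import Relation.Binary.PropositionalEquality using (_≡_; _≢_; refl; trans; cong; module ≡-Reasoning)
open import Relation.Nullary using (yes; no; contradiction)

private variable
  A : Set
  n b : ℕ

head-fibred-↔ : (A → Vec A b ↔ Vec A b) → Vec A (suc b) ↔ Vec A (suc b)
head-fibred-↔ ψ = mk↔ₛ′ to from to∘from from∘to
  where
  to from : Vec _ (suc _) → Vec _ (suc _)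
  to   (x ∷ v) = x ∷ Inverse.to   (ψ x) v
  from (x ∷ v) = x ∷ Inverse.from (ψ x) v
  to∘from : ∀ w → to (from w) ≡ w
  to∘from (x ∷ v) = cong (x ∷_) (Inverse.strictlyInverseˡ (ψ x) v)
  from∘to : ∀ w → from (to w) ≡ w
  from∘to (x ∷ v) = cong (x ∷_) (Inverse.strictlyInverseʳ (ψ x) v)

tail-fibred-↔ : (Vec A b → A ↔ A) → Vec A (suc b) ↔ Vec A (suc b)
tail-fibred-↔ σ = mk↔ₛ′ to from to∘from from∘to
  where
  to from : Vec _ (suc _) → Vec _ (suc _)
  to   (x ∷ v) = Inverse.to   (σ v) x ∷ v
  from (x ∷ v) = Inverse.from (σ v) x ∷ v
  to∘from : ∀ w → to (from w) ≡ w
  to∘from (x ∷ v) = cong (_∷ v) (Inverse.strictlyInverseˡ (σ v) x)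
  from∘to : ∀ w → from (to w) ≡ w
  from∘to (x ∷ v) = cong (_∷ v) (Inverse.strictlyInverseʳ (σ v) x)

transpose-matchˡ : (i j : Fin n) → transpose i j ⟨$⟩ʳ i ≡ j
transpose-matchˡ i j with i ≟ i
... | yes _  = refl
... | no i≢i = contradiction refl i≢i

Prescribing : (a : Fin n) → (Vec (Fin n) b → Fin b → Fin n) → Set
Prescribing {n} {b} a β = Σ (Vec (Fin n) b ↔ Vec (Fin n) b) λ φ →
  ∀ w i → lookup w i ≡ a → lookup (Inverse.to φ w) i ≡ β w i

prescribe-at-letter : (a : Fin n) (β : Vec (Fin n) b → Fin b → Fin n) → Prescribing a β
prescribe-at-letter {b = zero}      a β = ↔-id _ , λ _ ()
prescribe-at-letter {n} {b = suc b} a β = tail-fibred-↔ σ ↔-∘ head-fibred-↔ ψ , prescribed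
  where
  prescribe-tail : (x : Fin n) → Prescribing a (λ v i → β (x ∷ v) (suc i))
  prescribe-tail x = prescribe-at-letter a (λ v i → β (x ∷ v) (suc i))
  ψ : Fin n → Vec (Fin n) b ↔ Vec (Fin n) b
  ψ x = proj₁ (prescribe-tail x)
  σ : Vec (Fin n) b → Fin n ↔ Fin n
  σ u = transpose a (β (a ∷ Inverse.from (ψ a) u) zero)
  prescribed : ∀ w i → lookup w i ≡ a →
    lookup (Inverse.to (tail-fibred-↔ σ ↔-∘ head-fibred-↔ ψ) w) i ≡ β w i
  prescribed (x ∷ v) (suc i) x≡a = proj₂ (prescribe-tail x) v i x≡a
  prescribed (a ∷ v) zero refl = begin
    σ (Inverse.to (ψ a) v) ⟨$⟩ʳ a                        ≡⟨ transpose-matchˡ a _ ⟩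
    β (a ∷ Inverse.from (ψ a) (Inverse.to (ψ a) v)) zero ≡⟨ cong (λ u → β (a ∷ u) zero) (Inverse.strictlyInverseʳ (ψ a) v) ⟩
    β (a ∷ v) zero                                       ∎
    where open ≡-Reasoning

just-fromMaybe : (d : A) (m : Maybe A) → m ≢ nothing → just (fromMaybe d m) ≡ m
just-fromMaybe d (just x) _         = refl
just-fromMaybe d nothing  m≢nothing = contradiction refl m≢nothing

lemma2 : (k b : ℕ) → .{{_ : NonZero k}}
    → (α : Word k b → Fin b → Maybe (Fin k))
    → (∀ (w : Word k b) (i : Fin b) → (α w i ≢ nothing) ⇔ (lookup w i ≡ letter1 k))
    → Σ (Word k b ⤖ Word k b) λ φ →
    ∀ (w : Word k b) (i : Fin b) → lookup w i ≡ letter1 k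
    → just (lookup (Bijection.to φ w) i) ≡ α w i
lemma2 k b α α-defined =
  let φ , prescribed = prescribe-at-letter (letter1 k) β in
  ↔⇒⤖ φ , λ w i wᵢ≡1 →
    trans (cong just (prescribed w i wᵢ≡1))
          (just-fromMaybe (letter1 k) (α w i) (Equivalence.from (α-defined w i) wᵢ≡1))
  where
  β : Word k b → Fin b → Fin k
  β w i = fromMaybe (letter1 k) (α w i)
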